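{- Let $A$ be a poset with greatest element $1$ and let $\to$ be a binary operation on $A$. Then $\to$ is a relative pseudocomplementation on $A$ if and only if it satisfies the following three conditions for all $x,y,z,u\in A$: (i) if $x\le y\to z$, then $y\le x\to z$; (ii) if $x\le x\to y$, then $x\le y$; (iii) if every $v\in A$ with $v\le x$ and $v\le u$ satisfies $v\le y$, then $u\le x\to y$.
   Context: A binary operation $\to$ on a poset $A$ with greatest element $1$ is a relative pseudocomplementation if for all $x,y,u\in A$: (R1) if $u\le x\to y$, then every $v$ with $v\le x$ and $v\le u$ satisfies $v\le y$; and (R2) if every $v$ with $v\le x$ and $v\le u$ satisfies $v\le y$, then $u\le x\to y$. -}

module Defs where

open import Level using (Level; _⊔_)
open import Data.Product using (_×_)
open import Relation.Binary.Bundles using (Poset)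

module _ {a ℓ₁ ℓ₂ : Level} (P : Poset a ℓ₁ ℓ₂) where
  open Poset P

  R1 : (Carrier → Carrier → Carrier) → Set (a ⊔ ℓ₂)
  R1 _⇒_ = ∀ x y u → u ≤ (x ⇒ y) → ∀ v → v ≤ x → v ≤ u → v ≤ y

  R2 : (Carrier → Carrier → Carrier) → Set (a ⊔ ℓ₂)
  R2 _⇒_ = ∀ x y u → (∀ v → v ≤ x → v ≤ u → v ≤ y) → u ≤ (x ⇒ y)

  IsRelativePseudocomplementation : (Carrier → Carrier → Carrier) → Set (a ⊔ ℓ₂)
  IsRelativePseudocomplementation _⇒_ = R1 _⇒_ × R2 _⇒_

  CondI : (Carrier → Carrier → Carrier) → Set (a ⊔ ℓ₂)
  CondI _⇒_ = ∀ x y z → x ≤ (y ⇒ z) → y ≤ (x ⇒ z)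

  CondII : (Carrier → Carrier → Carrier) → Set (a ⊔ ℓ₂)
  CondII _⇒_ = ∀ x y → x ≤ (x ⇒ y) → x ≤ y

  CondIII : (Carrier → Carrier → Carrier) → Set (a ⊔ ℓ₂)
  CondIII = R2

module Submission where

-- Proof idea.  Both directions are short order-theoretic arguments, valid in
-- any poset.
--
--  * (R1),(R2) ⇒ (i): if x ≤ y ⇒ z then, by (R1), every common lower bound
--    of y and x lies below z, so (R2) gives y ≤ x ⇒ z.
--  * (R1) ⇒ (ii): apply (R1) to u = x and the lower bound v = x itself.
--  * (i),(ii) ⇒ (R1): for v ≤ x and v ≤ u ≤ x ⇒ y, condition (i) turns
--    v ≤ x ⇒ y into x ≤ v ⇒ y, hence v ≤ v ⇒ y, and (ii) yields v ≤ y.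
--  * (iii) is literally (R2).

open import Defs
open import Level using (Level)
open import Data.Product using (_×_; _,_)
open import Function.Bundles using (_⇔_; mk⇔)
open import Relation.Binary.Bundles using (Poset)
open import Relation.Binary.Definitions using (Maximum)

module _ {a ℓ₁ ℓ₂ : Level} (P : Poset a ℓ₁ ℓ₂)
         (_⇒_ : Poset.Carrier P → Poset.Carrier P → Poset.Carrier P) where
  open Poset P

  -- A relative pseudocomplementation satisfies the exchange law (i):
  -- the common lower bounds of x and y do not depend on the order.
  rpc⇒condI : R1 P _⇒_ → R2 P _⇒_ → CondI P _⇒_
  rpc⇒condI r1 r2 x y z x≤y⇒z =
    r2 x z y (λ v v≤x v≤y → r1 y z x x≤y⇒z v v≤y v≤x)

  -- (R1) alone gives (ii): x is a lower bound of itself.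
  r1⇒condII : R1 P _⇒_ → CondII P _⇒_
  r1⇒condII r1 x y x≤x⇒y = r1 x y x x≤x⇒y x refl refl

  condI∧condII⇒r1 : CondI P _⇒_ → CondII P _⇒_ → R1 P _⇒_
  condI∧condII⇒r1 cI cII x y u u≤x⇒y v v≤x v≤u = cII v y v≤v⇒y
    where
    x≤v⇒y : x ≤ (v ⇒ y)
    x≤v⇒y = cI v x y (trans v≤u u≤x⇒y)

    v≤v⇒y : v ≤ (v ⇒ y)
    v≤v⇒y = trans v≤x x≤v⇒y

theorem3p5 : {a ℓ₁ ℓ₂ : Level} (P : Poset a ℓ₁ ℓ₂)
    → (top : Poset.Carrier P) → Maximum (Poset._≤_ P) top
    → (_⇒_ : Poset.Carrier P → Poset.Carrier P → Poset.Carrier P)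
    → IsRelativePseudocomplementation P _⇒_ ⇔ (CondI P _⇒_ × CondII P _⇒_ × CondIII P _⇒_)
theorem3p5 P _ _ _⇒_ = mk⇔ to from
  where
  to : IsRelativePseudocomplementation P _⇒_ → CondI P _⇒_ × CondII P _⇒_ × CondIII P _⇒_
  to (r1 , r2) = rpc⇒condI P _⇒_ r1 r2 , r1⇒condII P _⇒_ r1 , r2

  from : CondI P _⇒_ × CondII P _⇒_ × CondIII P _⇒_ → IsRelativePseudocomplementation P _⇒_
  from (cI , cII , cIII) = condI∧condII⇒r1 P _⇒_ cI cII , cIII
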